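{- Let $A$ be a totally ordered alphabet and let $w\in A^*$ be a primitive word with a special factorization $w=a_1\pi_1a_2\pi_2\cdots\pi_{k-1}a_k$, such that $w$ is conjugate to $W=a_k\pi_{k-1}a_{k-1}\cdots\pi_2a_2\pi_1a_1$. Let $w'<w''$ be two conjugates of $w$ that are consecutive in the lexicographic order on the set of conjugates of $w$ (i.e. two consecutive rows of the Burrows–Wheeler matrix of $w$). Then there exist $i\in\{1,\ldots,k-1\}$ and a factorization $\pi_i=uv$ such that $$w'=v\,a_i\pi_{i-1}a_{i-1}\cdots\pi_1a_1\,a_k\pi_{k-1}a_{k-1}\cdots\pi_{i+1}a_{i+1}\,u$$ and $$w''=v\,a_{i+1}\pi_{i+1}a_{i+2}\cdots\pi_{k-1}a_k\,a_1\pi_1a_2\cdots\pi_{i-1}a_i\,u.$$ Moreover, $w$ is the smallest and $W$ is the largest element, for the lexicographic order, of the conjugation class of $w$.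
   Context: $Alph(w)$ is the set of letters occurring in $w$. A special factorization of $w$ is a factorization $w=a_1\pi_1a_2\pi_2\cdots\pi_{k-1}a_k$ where $Alph(w)=\{a_1<a_2<\cdots<a_k\}$ and $\pi_1,\ldots,\pi_{k-1}\in A^*$. A word is primitive if it is not a proper power. Two words are conjugate if they are of the form $xy$ and $yx$. The lexicographic order on words is induced by the order on $A$. The Burrows–Wheeler matrix of a primitive word has as rows its conjugates listed in increasing lexicographic order. -}

module Defs where

open import Data.Nat using (ℕ; _≤_)
open import Data.Product using (Σ; ∃; ∃-syntax; _×_; _,_; proj₂)
open import Data.List using (List; []; _∷_; _++_; [_]; map)
open import Relation.Binary.PropositionalEquality using (_≡_; _≢_)

_^_ : {A : Set} → List A → ℕ → List A
u ^ ℕ.zero = []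
u ^ ℕ.suc m = u ++ (u ^ m)

-- primitive = not a proper power (w ≠ u^m for every u and every m ≥ 2);
-- in particular the empty word (= []^2) is not primitive.
Primitive : {A : Set} → List A → Set
Primitive {A} w = ∀ (u : List A) (m : ℕ) → 2 ≤ m → w ≢ (u ^ m)

Conjugate : {A : Set} → List A → List A → Set
Conjugate {A} w z = ∃[ x ] ∃[ y ] (w ≡ x ++ y × z ≡ y ++ x)

-- A factorization data  a₁ , [(π₁ , a₂) , (π₂ , a₃) , … , (π_{k-1} , a_k)]
-- fwd a₁ ps = a₁ π₁ a₂ π₂ ⋯ π_{k-1} a_k
fwd : {A : Set} → A → List (List A × A) → List A
fwd a [] = [ a ]
fwd a ((p , b) ∷ ps) = a ∷ (p ++ fwd b ps)

-- bwd a₁ ps = a_k π_{k-1} a_{k-1} ⋯ π₂ a₂ π₁ a₁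
bwd : {A : Set} → A → List (List A × A) → List A
bwd a [] = [ a ]
bwd a ((p , b) ∷ ps) = bwd b ps ++ (p ++ [ a ])

letters : {A : Set} → A → List (List A × A) → List A
letters a ps = a ∷ map proj₂ ps

module Submission where

-- Cut w = a₁π₁a₂⋯π_{k-1}a_k and W = a_kπ_{k-1}⋯π₁a₁ inside the same factor π_i = uv.
-- The two rotations obtained both begin with v, followed by a_i resp. a_{i+1}, so the
-- rotation c of W is smaller than the rotation d of w.  Every conjugate except W is
-- such a c, every conjugate except w is such a d, and by primitivity d determines the
-- cut.  So c ↦ d is an increasing injection of the finite chain of conjugates, defined
-- everywhere but at W, and counting shows that it must be the successor map: the pairs
-- (c, d) are exactly the consecutive rows of the Burrows–Wheeler matrix, W is the
-- largest row and w the smallest.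

open import Defs
open import Data.Nat using (zero; suc; _+_; _<_; _≤_; s≤s; z≤n)
open import Data.Nat.Induction using (<-wellFounded)
open import Data.Nat.Properties using (≤-trans; ≤-reflexive; m≤n+m; <-irrefl)
open import Data.Product using (Σ; ∃; ∃-syntax; _×_; _,_; proj₁; proj₂)
open import Data.Sum using (_⊎_; inj₁; inj₂)
open import Data.List using (List; []; _∷_; _++_; [_]; length; map; filter; deduplicate)
open import Data.List.Properties
  using (++-assoc; ++-identityʳ; ++-identityʳ-unique; ++-cancelˡ; ++-conicalˡ; ++-conicalʳ;
         ∷-injective; ∷-injectiveʳ; length-++-≤ˡ; length-++-≤ʳ; length-++-sucʳ)
open import Data.List.Membership.Propositional using (_∈_)
open import Data.List.Membership.Propositional.Properties
  using (∈-map⁺; ∈-map⁻; ∈-∃++; ∈-++⁻; ∈-++⁺ˡ; ∈-++⁺ʳ; ∈-filter⁺; ∈-filter⁻;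
         ∈-deduplicate⁺; ∈-deduplicate⁻)
open import Data.List.Relation.Unary.Any using (here; there)
import Data.List.Relation.Unary.All as All
open import Data.List.Relation.Unary.AllPairs using (AllPairs; _∷_)
open import Data.List.Relation.Unary.Unique.Propositional using (Unique)
open import Data.List.Relation.Unary.Unique.Propositional.Properties using (filter⁺)
open import Data.List.Relation.Unary.Unique.DecPropositional.Properties using (deduplicate-!)
open import Data.List.Relation.Binary.Lex.Strict
  using (Lex-<; Lex-≤; base; halt; this; next; <-isStrictTotalOrder)
  renaming (≤-reflexive to Lex-≤-reflexive)
open import Data.List.Relation.Binary.Pointwise using (≡⇒Pointwise-≡; Pointwise-≡⇒≡)
open import Data.Empty using (⊥; ⊥-elim)
open import Function using (_∘_)
open import Function.Bundles using (_⇔_)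
open import Induction.WellFounded using (Acc; acc)
open import Level using (0ℓ)
import Level
open import Relation.Binary.Core using (Rel)
open import Relation.Binary.Definitions using (Trichotomous; tri<; tri≈; tri>)
open import Relation.Binary.Structures using (IsStrictTotalOrder)
import Relation.Binary.Construct.Flip.EqAndOrd as Flip
open import Relation.Binary.PropositionalEquality hiding ([_])
open import Relation.Nullary using (¬_; Dec; yes; no)
open import Relation.Nullary.Decidable using (¬?)

-- Combinatorics on words

module _ {A : Set} where

  ++-equidivisible : (p q r s : List A) → p ++ q ≡ r ++ s →
    (∃ λ m → r ≡ p ++ m × q ≡ m ++ s) ⊎ (∃ λ m → p ≡ r ++ m × s ≡ m ++ q)
  ++-equidivisible []      q r       s eq = inj₁ (r , refl , eq)
  ++-equidivisible (c ∷ p) q []      s eq = inj₂ (c ∷ p , refl , sym eq)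
  ++-equidivisible (c ∷ p) q (d ∷ r) s eq with ∷-injective eq
  ... | refl , eq′ with ++-equidivisible p q r s eq′
  ...   | inj₁ (m , r≡pm , q≡ms) = inj₁ (m , cong (c ∷_) r≡pm , q≡ms)
  ...   | inj₂ (m , p≡rm , s≡mq) = inj₂ (m , cong (c ∷_) p≡rm , s≡mq)

  []^ : ∀ m → ([] {A = A}) ^ m ≡ []
  []^ zero    = refl
  []^ (suc m) = []^ m

  ^-+ : ∀ (z : List A) i j → z ^ i ++ z ^ j ≡ z ^ (i + j)
  ^-+ z zero    j = refl
  ^-+ z (suc i) j = trans (++-assoc z (z ^ i) (z ^ j)) (cong (z ++_) (^-+ z i j))

  ++-comm⇒common-root : ∀ (p q : List A) → p ++ q ≡ q ++ p →
    ∃[ z ] ∃[ i ] ∃[ j ] (p ≡ z ^ i × q ≡ z ^ j)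
  ++-comm⇒common-root p q = go p q (<-wellFounded (length (p ++ q)))
    where
    shorter-suffix : ∀ c (p q : List A) → length q < length (c ∷ p ++ q)
    shorter-suffix c p q = s≤s (length-++-≤ʳ q {p})

    shorter-prefix : ∀ (p : List A) d q → length p < length (p ++ d ∷ q)
    shorter-prefix p d q =
      ≤-trans (s≤s (length-++-≤ˡ p)) (≤-reflexive (sym (length-++-sucʳ p d q)))

    go : ∀ (p q : List A) → Acc _<_ (length (p ++ q)) → p ++ q ≡ q ++ p →
         ∃[ z ] ∃[ i ] ∃[ j ] (p ≡ z ^ i × q ≡ z ^ j)
    go [] q _ _ = q , 0 , 1 , refl , sym (++-identityʳ q)
    go p@(_ ∷ _) [] _ _ = p , 1 , 0 , sym (++-identityʳ p) , refl
    go p@(c ∷ p′) q@(d ∷ q′) (acc rec) pq≡qp with ++-equidivisible p q q p pq≡qp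
    ... | inj₁ (m , q≡pm , q≡mp)
      with z , i , j , p≡zⁱ , m≡zʲ
             ← go p m (rec (subst (_< length (p ++ q)) (cong length q≡pm) (shorter-suffix c p′ q)))
                      (trans (sym q≡pm) q≡mp)
      = z , i , i + j , p≡zⁱ , trans q≡pm (trans (cong₂ _++_ p≡zⁱ m≡zʲ) (^-+ z i j))
    ... | inj₂ (m , p≡qm , p≡mq)
      with z , i , j , m≡zⁱ , q≡zʲ
             ← go m q (rec (subst (_< length (p ++ q)) (cong length p≡mq) (shorter-prefix p d q′)))
                      (trans (sym p≡mq) p≡qm)
      = z , j + i , j , trans p≡qm (trans (cong₂ _++_ q≡zʲ m≡zⁱ) (^-+ z j i)) , q≡zʲ

  ^-conjugate : ∀ (r s : List A) m → r ++ (s ++ r) ^ m ≡ (r ++ s) ^ m ++ r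
  ^-conjugate r s zero    = ++-identityʳ r
  ^-conjugate r s (suc m) = begin
    r ++ ((s ++ r) ++ (s ++ r) ^ m)   ≡⟨ cong (r ++_) (++-assoc s r _) ⟩
    r ++ (s ++ (r ++ (s ++ r) ^ m))   ≡⟨ ++-assoc r s _ ⟨
    (r ++ s) ++ (r ++ (s ++ r) ^ m)   ≡⟨ cong ((r ++ s) ++_) (^-conjugate r s m) ⟩
    (r ++ s) ++ ((r ++ s) ^ m ++ r)   ≡⟨ ++-assoc (r ++ s) _ r ⟨
    (r ++ s) ^ suc m ++ r             ∎
    where open ≡-Reasoning

  conjugate-of-power : ∀ (z : List A) m x y → z ^ m ≡ x ++ y → ∃ λ z′ → y ++ x ≡ z′ ^ m
  conjugate-of-power z m [] y zᵐ≡y = z , trans (++-identityʳ y) (sym zᵐ≡y)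
  conjugate-of-power [] m (c ∷ x) y []ᵐ≡cxy with () ← trans (sym ([]^ m)) []ᵐ≡cxy
  conjugate-of-power (d ∷ z) m (c ∷ x) y zᵐ≡cxy
    with refl , rotated ← ∷-injective (trans (^-conjugate [ d ] z m) (cong (_++ [ d ]) zᵐ≡cxy))
    with z′ , rotated′ ← conjugate-of-power (z ++ [ d ]) m x (y ++ [ d ])
                           (trans rotated (++-assoc x y [ d ]))
    = z′ , trans (sym (++-assoc y [ d ] x)) rotated′

  conjugate-sym : ∀ {w z : List A} → Conjugate w z → Conjugate z w
  conjugate-sym (x , y , w≡xy , z≡yx) = y , x , z≡yx , w≡xy

  conjugate-trans : ∀ {w z z′ : List A} → Conjugate w z → Conjugate z z′ → Conjugate w z′
  conjugate-trans (x , y , w≡xy , z≡yx) (p , q , z≡pq , z′≡qp)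
    with ++-equidivisible y x p q (trans (sym z≡yx) z≡pq)
  ... | inj₁ (m , p≡ym , x≡mq) =
    m , q ++ y , trans w≡xy (trans (cong (_++ y) x≡mq) (++-assoc m q y)) ,
    trans z′≡qp (trans (cong (q ++_) p≡ym) (sym (++-assoc q y m)))
  ... | inj₂ (m , y≡pm , q≡mx) =
    x ++ p , m , trans w≡xy (trans (cong (x ++_) y≡pm) (sym (++-assoc x p m))) ,
    trans z′≡qp (trans (cong (_++ p) q≡mx) (++-assoc m x p))

  proper-conjugate : ∀ {w z : List A} → Conjugate w z → z ≢ w →
    ∃[ x ] ∃[ y ] (w ≡ x ++ y × z ≡ y ++ x × x ≢ [] × y ≢ [])
  proper-conjugate {w} {z} (x , y , w≡xy , z≡yx) z≢w = x , y , w≡xy , z≡yx , x≢[] , y≢[]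
    where
    x≢[] : x ≢ []
    x≢[] refl = z≢w (trans z≡yx (trans (++-identityʳ y) (sym w≡xy)))
    y≢[] : y ≢ []
    y≢[] refl = z≢w (trans z≡yx (trans (sym (++-identityʳ x)) (sym w≡xy)))

  primitive-conjugate : ∀ {w z : List A} → Primitive w → Conjugate w z → Primitive z
  primitive-conjugate prim (x , y , w≡xy , z≡yx) u m 2≤m z≡uᵐ
    with u′ , xy≡u′ᵐ ← conjugate-of-power u m y x (trans (sym z≡uᵐ) z≡yx)
    = prim u′ m 2≤m (trans w≡xy xy≡u′ᵐ)

  primitive⇒¬commute : ∀ (p q : List A) → Primitive (p ++ q) → p ++ q ≡ q ++ p →
                       p ≢ [] → q ≢ [] → ⊥
  primitive⇒¬commute p q prim pq≡qp p≢[] q≢[]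
    with ++-comm⇒common-root p q pq≡qp
  ... | z , zero  , j     , refl , _    = p≢[] refl
  ... | z , suc i , zero  , _    , refl = q≢[] refl
  ... | z , suc i , suc j , refl , refl =
    prim z (suc i + suc j) (s≤s (≤-trans (s≤s z≤n) (m≤n+m (suc j) i))) (^-+ z (suc i) (suc j))

  rotation-shift-trivial : ∀ {x m y : List A} → Primitive (x ++ m ++ y) →
                           (m ++ y) ++ x ≡ y ++ x ++ m → y ≢ [] → m ≡ []
  rotation-shift-trivial {x} {[]}          _    _   _    = refl
  rotation-shift-trivial {x} {m@(_ ∷ _)} {y} prim rot y≢[] = ⊥-elim
    (primitive⇒¬commute m (y ++ x)
      (primitive-conjugate prim (x , m ++ y , refl , sym (++-assoc m y x)))
      (trans (sym (++-assoc m y x)) (trans rot (sym (++-assoc y x m))))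
      (λ ()) (λ yx≡[] → y≢[] (++-conicalˡ y x yx≡[])))

  rotation-injective : ∀ {w x y x′ y′ : List A} → Primitive w →
    w ≡ x ++ y → w ≡ x′ ++ y′ → y ++ x ≡ y′ ++ x′ → y ≢ [] → y′ ≢ [] → x ≡ x′
  rotation-injective {x = x} {x′ = x′} prim refl w≡x′y′ yx≡y′x′ y≢[] y′≢[]
    with ++-equidivisible x _ x′ _ w≡x′y′
  ... | inj₁ (m , refl , refl) =
    sym (trans (cong (x ++_) (rotation-shift-trivial prim yx≡y′x′ y′≢[])) (++-identityʳ x))
  ... | inj₂ (m , refl , refl) =
    trans (cong (x′ ++_)
            (rotation-shift-trivial (subst Primitive w≡x′y′ prim) (sym yx≡y′x′) y≢[]))
          (++-identityʳ x′)

  splits : List A → List (List A × List A)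
  splits []      = ([] , []) ∷ []
  splits (c ∷ w) = ([] , c ∷ w) ∷ map (λ (x , y) → (c ∷ x , y)) (splits w)

  ∈-splits⁺ : ∀ (x y : List A) → (x , y) ∈ splits (x ++ y)
  ∈-splits⁺ []      []      = here refl
  ∈-splits⁺ []      (_ ∷ _) = here refl
  ∈-splits⁺ (c ∷ x) y       = there (∈-map⁺ _ (∈-splits⁺ x y))

  ∈-splits⁻ : ∀ (w : List A) {x y} → (x , y) ∈ splits w → w ≡ x ++ y
  ∈-splits⁻ []      (here refl) = refl
  ∈-splits⁻ (c ∷ w) (here refl) = refl
  ∈-splits⁻ (c ∷ w) (there xy∈) with _ , x′y∈ , refl ← ∈-map⁻ _ xy∈ =
    cong (c ∷_) (∈-splits⁻ w x′y∈)

  conjugates : List A → List (List A)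
  conjugates w = map (λ (x , y) → y ++ x) (splits w)

  ∈-conjugates⁺ : ∀ {w z : List A} → Conjugate w z → z ∈ conjugates w
  ∈-conjugates⁺ (x , y , refl , refl) = ∈-map⁺ _ (∈-splits⁺ x y)

  ∈-conjugates⁻ : ∀ {w z : List A} → z ∈ conjugates w → Conjugate w z
  ∈-conjugates⁻ {w} z∈ with (x , y) , xy∈ , refl ← ∈-map⁻ _ z∈ = x , y , ∈-splits⁻ w xy∈ , refl

-- Finite sets under a strict total order

∈-delete : ∀ {X : Set} {x y : X} xs ys → y ∈ xs ++ [ x ] ++ ys → y ≢ x → y ∈ xs ++ ys
∈-delete xs ys y∈ y≢x with ∈-++⁻ xs y∈
... | inj₁ y∈xs         = ∈-++⁺ˡ y∈xs
... | inj₂ (here y≡x)   = ⊥-elim (y≢x y≡x)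
... | inj₂ (there y∈ys) = ∈-++⁺ʳ xs y∈ys

injection⇒length-≤ : ∀ {X Y : Set} {D : List X} {S : List Y} (Q : X → Y → Set) → Unique D →
  (∀ {c} → c ∈ D → ∃ λ d → d ∈ S × Q c d) →
  (∀ {c c′ d} → Q c d → Q c′ d → c ≡ c′) →
  length D ≤ length S
injection⇒length-≤ {D = []} Q _ _ _ = z≤n
injection⇒length-≤ {D = c ∷ D} {S} Q (c∉D ∷ D!) image Q-injective
  with d , d∈S , Qcd ← image (here refl)
  with S₁ , S₂ , refl ← ∈-∃++ d∈S
  = ≤-trans (s≤s (injection⇒length-≤ Q D! image′ Q-injective))
            (≤-reflexive (sym (length-++-sucʳ S₁ d S₂)))
  where
  image′ : ∀ {c′} → c′ ∈ D → ∃ λ d′ → d′ ∈ S₁ ++ S₂ × Q c′ d′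
  image′ c′∈D with d′ , d′∈S , Qc′d′ ← image (there c′∈D) =
    d′ , ∈-delete S₁ S₂ d′∈S (λ { refl → All.lookup c∉D c′∈D (Q-injective Qcd Qc′d′) }) , Qc′d′

module _ {X : Set} {_<_ : Rel X 0ℓ} (sto : IsStrictTotalOrder _≡_ _<_) where
  open IsStrictTotalOrder sto renaming (trans to <-trans)

  maximal-element : ∀ x xs → ∃ λ m → m ∈ x ∷ xs × (∀ {y} → y ∈ x ∷ xs → ¬ m < y)
  maximal-element x [] = x , here refl , λ { (here refl) → irrefl refl }
  maximal-element x (y ∷ ys) with m , m∈ , m-maximal ← maximal-element y ys with compare x m
  ... | tri< x<m _ _ = m , there m∈ , λ { (here refl) → asym x<m ; (there y∈) → m-maximal y∈ }
  ... | tri≈ _ refl _ = m , there m∈ , λ { (here refl) → irrefl refl ; (there y∈) → m-maximal y∈ }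
  ... | tri> _ _ m<x = x , here refl ,
    λ { (here refl) → irrefl refl ; (there y∈) x<y → m-maximal y∈ (<-trans m<x x<y) }

  sole-maximal⇒maximum : ∀ {C : List X} {M : X} →
    (∀ {c} → c ∈ C → c ≢ M → ∃ λ d → d ∈ C × c < d) →
    ∀ {z} → z ∈ C → ¬ M < z
  sole-maximal⇒maximum {C = x ∷ xs} {M} bounded z∈C
    with m , m∈C , m-maximal ← maximal-element x xs
    with m ≟ M
  ... | yes refl = m-maximal z∈C
  ... | no m≢M with d , d∈C , m<d ← bounded m∈C m≢M = ⊥-elim (m-maximal d∈C m<d)

  module IncreasingInjection
    {C : List X} (C! : Unique C) {R : Rel X 0ℓ} {M : X}
    (R-closed     : ∀ {c d} → R c d → d ∈ C)
    (R-increasing : ∀ {c d} → R c d → c < d)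
    (R-injective  : ∀ {c c′ d} → R c d → R c′ d → c ≡ c′)
    (R-total      : ∀ {c} → c ∈ C → c ≢ M → ∃ (R c))
    where

    M-maximum : ∀ {z} → z ∈ C → ¬ M < z
    M-maximum = sole-maximal⇒maximum λ c∈C c≢M →
      let d , Rcd = R-total c∈C c≢M in d , R-closed Rcd , R-increasing Rcd

    below⇒≢M : ∀ {c d} → d ∈ C → c < d → c ≢ M
    below⇒≢M d∈C c<d refl = M-maximum d∈C c<d

    consecutive⇒R : ∀ {w′ w″} → w′ ∈ C → w″ ∈ C → w′ < w″ →
                    (∀ {z} → z ∈ C → ¬ (w′ < z × z < w″)) → R w′ w″
    consecutive⇒R {w′} {w″} w′∈C w″∈C w′<w″ nothing-between
      with e , Rw′e ← R-total w′∈C (below⇒≢M w″∈C w′<w″)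
      with compare e w″
    ... | tri≈ _ refl _ = Rw′e
    ... | tri< e<w″ _ _ = ⊥-elim (nothing-between (R-closed Rw′e) (R-increasing Rw′e , e<w″))
    ... | tri> _ _ w″<e = ⊥-elim (<-irrefl refl (injection⇒length-≤ Q (w′∉S ∷ S!) image Q-injective))
      where
      ≮w″? : ∀ z → Dec (¬ z < w″)
      ≮w″? z = ¬? (z <? w″)

      S : List X
      S = filter ≮w″? C

      S! : Unique S
      S! = filter⁺ ≮w″? {C} C!

      w′∉S : All.All (w′ ≢_) S
      w′∉S = All.tabulate λ z∈S w′≡z →
        proj₂ (∈-filter⁻ ≮w″? {xs = C} z∈S) (subst (_< w″) w′≡z w′<w″)

      -- If R w′ e with w″ < e, then w′ ∷ S injects into S = {z ∈ C ∣ w″ ≤ z}: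
      -- M ↦ w″, and every other element goes to its R-image, strictly above w″.
      Q : X → X → Set
      Q c d = (c ≢ M × R c d × d ≢ w″) ⊎ (c ≡ M × d ≡ w″)

      image : ∀ {c} → c ∈ w′ ∷ S → ∃ λ d → d ∈ S × Q c d
      image (here refl) =
        e , ∈-filter⁺ ≮w″? (R-closed Rw′e) (asym w″<e) ,
        inj₁ (below⇒≢M w″∈C w′<w″ , Rw′e , λ { refl → irrefl refl w″<e })
      image {c} (there c∈S) with c∈C , c≮w″ ← ∈-filter⁻ ≮w″? {xs = C} c∈S with c ≟ M
      ... | yes c≡M = w″ , ∈-filter⁺ ≮w″? w″∈C (irrefl refl) , inj₂ (c≡M , refl)
      ... | no c≢M with d , Rcd ← R-total c∈C c≢M =
        d , ∈-filter⁺ ≮w″? (R-closed Rcd) (λ d<w″ → c≮w″ (<-trans (R-increasing Rcd) d<w″)) ,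
        inj₁ (c≢M , Rcd , λ { refl → c≮w″ (R-increasing Rcd) })

      Q-injective : ∀ {c c′ d} → Q c d → Q c′ d → c ≡ c′
      Q-injective (inj₁ (_ , Rcd , _))  (inj₁ (_ , Rc′d , _)) = R-injective Rcd Rc′d
      Q-injective (inj₁ (_ , _ , d≢w″)) (inj₂ (_ , d≡w″))     = ⊥-elim (d≢w″ d≡w″)
      Q-injective (inj₂ (_ , d≡w″))     (inj₁ (_ , _ , d≢w″)) = ⊥-elim (d≢w″ d≡w″)
      Q-injective (inj₂ (refl , _))     (inj₂ (refl , _))     = refl

-- Lexicographic order

module _ {A : Set} {_<_ : Rel A 0ℓ} where

  Lex-<-prefix : ∀ v {xs ys : List A} → Lex-< _≡_ _<_ xs ys → Lex-< _≡_ _<_ (v ++ xs) (v ++ ys)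
  Lex-<-prefix []      xs<ys = xs<ys
  Lex-<-prefix (c ∷ v) xs<ys = next refl (Lex-<-prefix v xs<ys)

  Lex-<⇒Lex-≤ : ∀ {xs ys : List A} → Lex-< _≡_ _<_ xs ys → Lex-≤ _≡_ _<_ xs ys
  Lex-<⇒Lex-≤ (base ())
  Lex-<⇒Lex-≤ halt           = halt
  Lex-<⇒Lex-≤ (this x<y)     = this x<y
  Lex-<⇒Lex-≤ (next x≡y lt)  = next x≡y (Lex-<⇒Lex-≤ lt)

  Lex-<-isStrictTotalOrder : IsStrictTotalOrder _≡_ _<_ → IsStrictTotalOrder _≡_ (Lex-< _≡_ _<_)
  Lex-<-isStrictTotalOrder sto = record
    { isStrictPartialOrder = record
      { isEquivalence = isEquivalence
      ; irrefl        = irrefl ∘ ≡⇒Pointwise-≡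
      ; trans         = <-trans
      ; <-resp-≈      = resp₂ (Lex-< _≡_ _<_)
      }
    ; compare = compare′
    }
    where
    open IsStrictTotalOrder (<-isStrictTotalOrder sto)
      using (irrefl; compare) renaming (trans to <-trans)
    compare′ : Trichotomous _≡_ (Lex-< _≡_ _<_)
    compare′ xs ys with compare xs ys
    ... | tri< lt ≉ ≯ = tri< lt (≉ ∘ ≡⇒Pointwise-≡) ≯
    ... | tri≈ ≮ ≈ ≯ = tri≈ ≮ (Pointwise-≡⇒≡ ≈) ≯
    ... | tri> ≮ ≉ gt = tri> ≮ (≉ ∘ ≡⇒Pointwise-≡) gt

  ≮⇒Lex-≤ : IsStrictTotalOrder _≡_ _<_ → ∀ {xs ys : List A} →
            ¬ Lex-< _≡_ _<_ ys xs → Lex-≤ _≡_ _<_ xs ys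
  ≮⇒Lex-≤ sto {xs} {ys} ys≮xs with IsStrictTotalOrder.compare (Lex-<-isStrictTotalOrder sto) xs ys
  ... | tri< lt _ _    = Lex-<⇒Lex-≤ lt
  ... | tri≈ _ refl _  = Lex-≤-reflexive _≡_ _<_ (≡⇒Pointwise-≡ refl)
  ... | tri> _ _ gt    = ⊥-elim (ys≮xs gt)

-- Cuts of a special factorization

module _ {A : Set} where

  -- A cut of a π₁ a₂ ⋯ π_{k-1} a_k strictly inside the word lies inside some π_i = u v,
  -- between u and v; the same data cuts W = a_k π_{k-1} ⋯ π₁ a between u and v.
  data Cut : A → List (List A × A) → Set where
    here  : ∀ {a p b ps} (u v : List A) → p ≡ u ++ v → Cut a ((p , b) ∷ ps)
    there : ∀ {a p b ps} → Cut b ps → Cut a ((p , b) ∷ ps)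

  fwdˡ fwdʳ bwdˡ bwdʳ : ∀ {a ps} → Cut a ps → List A
  fwdˡ {a} (here u v _)            = a ∷ u
  fwdˡ {a} (there {p = p} t)       = a ∷ p ++ fwdˡ t
  fwdʳ (here {b = b} {ps} u v _)   = v ++ fwd b ps
  fwdʳ (there t)                   = fwdʳ t
  bwdˡ (here {b = b} {ps} u v _)   = bwd b ps ++ u
  bwdˡ (there t)                   = bwdˡ t
  bwdʳ {a} (here u v _)            = v ++ [ a ]
  bwdʳ {a} (there {p = p} t)       = bwdʳ t ++ p ++ [ a ]

  fwd-cut : ∀ {a ps} (t : Cut a ps) → fwd a ps ≡ fwdˡ t ++ fwdʳ t
  fwd-cut (here {b = b} {ps} u v refl) = cong (_ ∷_) (++-assoc u v (fwd b ps))
  fwd-cut (there {p = p} t) =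
    cong (_ ∷_) (trans (cong (p ++_) (fwd-cut t)) (sym (++-assoc p _ _)))

  bwd-cut : ∀ {a ps} (t : Cut a ps) → bwd a ps ≡ bwdˡ t ++ bwdʳ t
  bwd-cut {a} (here {b = b} {ps} u v refl) = begin
    bwd b ps ++ (u ++ v) ++ [ a ]   ≡⟨ cong (bwd b ps ++_) (++-assoc u v [ a ]) ⟩
    bwd b ps ++ u ++ v ++ [ a ]     ≡⟨ ++-assoc (bwd b ps) u _ ⟨
    (bwd b ps ++ u) ++ v ++ [ a ]   ∎
    where open ≡-Reasoning
  bwd-cut (there t) = trans (cong (_++ _) (bwd-cut t)) (++-assoc (bwdˡ t) (bwdʳ t) _)

  fwd≢[] : ∀ (a : A) ps → fwd a ps ≢ []
  fwd≢[] a []      ()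
  fwd≢[] a (_ ∷ _) ()

  fwdˡ≢[] : ∀ {a ps} (t : Cut a ps) → fwdˡ t ≢ []
  fwdˡ≢[] (here _ _ _) ()
  fwdˡ≢[] (there _)    ()

  fwdʳ≢[] : ∀ {a ps} (t : Cut a ps) → fwdʳ t ≢ []
  fwdʳ≢[] (here {b = b} {ps} u v _) vw≡[] = fwd≢[] b ps (++-conicalʳ v _ vw≡[])
  fwdʳ≢[] (there t)                 = fwdʳ≢[] t

  fwd-cut-exists : ∀ a ps {x y} → fwd a ps ≡ x ++ y → x ≢ [] → y ≢ [] →
                   Σ (Cut a ps) λ t → x ≡ fwdˡ t × y ≡ fwdʳ t
  fwd-cut-exists a ps {[]} _ x≢[] _ = ⊥-elim (x≢[] refl)
  fwd-cut-exists a [] {_ ∷ x} {y} eq _ y≢[] =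
    ⊥-elim (y≢[] (++-conicalʳ x y (sym (∷-injectiveʳ eq))))
  fwd-cut-exists a ((p , b) ∷ ps) {_ ∷ x} {y} eq _ y≢[]
    with refl , eq′ ← ∷-injective eq
    with ++-equidivisible p (fwd b ps) x y eq′
  ... | inj₂ (m , p≡xm , y≡m++) = here x m p≡xm , refl , y≡m++
  ... | inj₁ ([] , x≡p++[] , fwd≡y) =
    here p [] (sym (++-identityʳ p)) , cong (a ∷_) (trans x≡p++[] (++-identityʳ p)) , sym fwd≡y
  ... | inj₁ (m@(_ ∷ _) , x≡pm , fwd≡my)
    with t , m≡ , y≡ ← fwd-cut-exists b ps fwd≡my (λ ()) y≢[]
    = there t , cong (a ∷_) (trans x≡pm (cong (p ++_) m≡)) , y≡

  bwd-cut-exists : ∀ a ps {x y} → bwd a ps ≡ x ++ y → x ≢ [] → y ≢ [] →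
                   Σ (Cut a ps) λ t → x ≡ bwdˡ t × y ≡ bwdʳ t
  bwd-cut-exists a [] {[]} _ x≢[] _ = ⊥-elim (x≢[] refl)
  bwd-cut-exists a [] {_ ∷ x} {y} eq _ y≢[] =
    ⊥-elim (y≢[] (++-conicalʳ x y (sym (∷-injectiveʳ eq))))
  bwd-cut-exists a ((p , b) ∷ ps) {x} {y} eq x≢[] y≢[]
    with ++-equidivisible (bwd b ps) (p ++ [ a ]) x y eq
  ... | inj₂ ([] , bwd≡x++[] , y≡) =
    here [] p refl ,
    trans (sym (++-identityʳ x)) (trans (sym bwd≡x++[]) (sym (++-identityʳ _))) , y≡
  ... | inj₂ (m@(_ ∷ _) , bwd≡xm , y≡mpa)
    with t , x≡ , m≡ ← bwd-cut-exists b ps bwd≡xm x≢[] (λ ())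
    = there t , x≡ , trans y≡mpa (cong (_++ p ++ [ a ]) m≡)
  ... | inj₁ (m , x≡bm , pa≡my) with ++-equidivisible p [ a ] m y pa≡my
  ...   | inj₂ (m′ , p≡mm′ , y≡m′a) = here m m′ p≡mm′ , x≡bm , y≡m′a
  ...   | inj₁ ([] , m≡p++[] , a≡y) =
    here p [] (sym (++-identityʳ p)) ,
    trans x≡bm (cong (bwd b ps ++_) (trans m≡p++[] (++-identityʳ p))) , sym a≡y
  ...   | inj₁ (_ ∷ m′ , _ , a≡) = ⊥-elim (y≢[] (++-conicalʳ m′ y (sym (∷-injectiveʳ a≡))))

  fwdˡ-injective : ∀ {a ps} (t s : Cut a ps) → fwdˡ t ≡ fwdˡ s → t ≡ s
  fwdˡ-injective (here u v refl) (here .u v′ uv≡uv′) refl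
    with refl ← ++-cancelˡ u v v′ uv≡uv′ | refl ← uv≡uv′ = refl
  fwdˡ-injective (here u v refl) (there s) eq = ⊥-elim (fwdˡ≢[] s (++-conicalʳ v _
    (++-identityʳ-unique u (trans (∷-injectiveʳ eq) (++-assoc u v _)))))
  fwdˡ-injective (there t) (here u v refl) eq = ⊥-elim (fwdˡ≢[] t (++-conicalʳ v _
    (++-identityʳ-unique u (trans (sym (∷-injectiveʳ eq)) (++-assoc u v _)))))
  fwdˡ-injective (there {p = p} t) (there s) eq =
    cong there (fwdˡ-injective t s (++-cancelˡ p _ _ (∷-injectiveʳ eq)))

  cut-decomposition : ∀ {a ps} (t : Cut a ps) →
    ∃[ ps₁ ] ∃[ π ] ∃[ b ] ∃[ ps₂ ] ∃[ u ] ∃[ v ]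
      (ps ≡ ps₁ ++ ((π , b) ∷ ps₂) × π ≡ u ++ v ×
       fwdˡ t ≡ fwd a ps₁ ++ u × fwdʳ t ≡ v ++ fwd b ps₂ ×
       bwdˡ t ≡ bwd b ps₂ ++ u × bwdʳ t ≡ v ++ bwd a ps₁)
  cut-decomposition (here {p = p} {b} {ps} u v p≡uv) =
    [] , p , b , ps , u , v , refl , p≡uv , refl , refl , refl , refl
  cut-decomposition {a} (there {p = p} {c} t)
    with ps₁ , π , b , ps₂ , u , v , ps≡ , π≡ , fwdˡ≡ , fwdʳ≡ , bwdˡ≡ , bwdʳ≡ ← cut-decomposition t
    = (p , c) ∷ ps₁ , π , b , ps₂ , u , v , cong ((p , c) ∷_) ps≡ , π≡ ,
      cong (a ∷_) (trans (cong (p ++_) fwdˡ≡) (sym (++-assoc p _ u))) , fwdʳ≡ , bwdˡ≡ ,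
      trans (cong (_++ p ++ [ a ]) bwdʳ≡) (++-assoc v _ _)

module _ {A : Set} {_<_ : Rel A 0ℓ} where

  bwdʳ-<-fwdʳ : ∀ {a ps} → AllPairs _<_ (letters a ps) → (t : Cut a ps) →
                ∀ xs ys → Lex-< _≡_ _<_ (bwdʳ t ++ xs) (fwdʳ t ++ ys)
  bwdʳ-<-fwdʳ {a} (a<letters ∷ _) (here {b = b} {ps} u v _) xs ys =
    subst₂ (Lex-< _≡_ _<_) (sym (++-assoc v [ a ] xs)) (sym (++-assoc v (fwd b ps) ys))
      (Lex-<-prefix v (head-< ps))
    where
    head-< : ∀ ps → Lex-< _≡_ _<_ (a ∷ xs) (fwd b ps ++ ys)
    head-< []      = this (All.head a<letters)
    head-< (_ ∷ _) = this (All.head a<letters)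
  bwdʳ-<-fwdʳ {a} (_ ∷ ordered) (there {p = p} t) xs ys =
    subst (λ zs → Lex-< _≡_ _<_ zs (fwdʳ t ++ ys)) (sym (++-assoc (bwdʳ t) (p ++ [ a ]) xs))
      (bwdʳ-<-fwdʳ ordered t (_ ++ xs) ys)

module _ {A : Set} (a : A) (ps : List (List A × A)) where

  SameCut : Rel (List A) 0ℓ
  SameCut c d = Σ (Cut a ps) λ t → c ≡ bwdʳ t ++ bwdˡ t × d ≡ fwdʳ t ++ fwdˡ t

  SameCut-conjugates : ∀ {c d} → SameCut c d → Conjugate (bwd a ps) c × Conjugate (fwd a ps) d
  SameCut-conjugates (t , refl , refl) =
    (bwdˡ t , bwdʳ t , bwd-cut t , refl) , (fwdˡ t , fwdʳ t , fwd-cut t , refl)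

  SameCut-from-bwd : ∀ {c} → Conjugate (bwd a ps) c → c ≢ bwd a ps → ∃ (SameCut c)
  SameCut-from-bwd W~c c≢W
    with x , y , W≡xy , c≡yx , x≢[] , y≢[] ← proper-conjugate W~c c≢W
    with t , x≡ , y≡ ← bwd-cut-exists a ps W≡xy x≢[] y≢[]
    = _ , t , trans c≡yx (cong₂ _++_ y≡ x≡) , refl

  SameCut-from-fwd : ∀ {d} → Conjugate (fwd a ps) d → d ≢ fwd a ps → ∃ λ c → SameCut c d
  SameCut-from-fwd w~d d≢w
    with x , y , w≡xy , d≡yx , x≢[] , y≢[] ← proper-conjugate w~d d≢w
    with t , x≡ , y≡ ← fwd-cut-exists a ps w≡xy x≢[] y≢[]
    = _ , t , refl , trans d≡yx (cong₂ _++_ y≡ x≡)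

  SameCut-injective : Primitive (fwd a ps) → ∀ {c c′ d} → SameCut c d → SameCut c′ d → c ≡ c′
  SameCut-injective prim (t , refl , d≡) (s , refl , d≡′)
    with refl ← fwdˡ-injective t s (rotation-injective prim (fwd-cut t) (fwd-cut s)
                                      (trans (sym d≡) d≡′) (fwdʳ≢[] t) (fwdʳ≢[] s))
    = refl

  SameCut-increasing : ∀ {_<_ : Rel A 0ℓ} → AllPairs _<_ (letters a ps) →
                       ∀ {c d} → SameCut c d → Lex-< _≡_ _<_ c d
  SameCut-increasing ordered (t , refl , refl) = bwdʳ-<-fwdʳ ordered t (bwdˡ t) (fwdˡ t)

  SameCut-decomposition : ∀ {c d} → SameCut c d →
    ∃[ ps₁ ] ∃[ π ] ∃[ b ] ∃[ ps₂ ] ∃[ u ] ∃[ v ]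
      (ps ≡ ps₁ ++ ((π , b) ∷ ps₂) × π ≡ u ++ v ×
       c ≡ v ++ (bwd a ps₁ ++ (bwd b ps₂ ++ u)) ×
       d ≡ v ++ (fwd b ps₂ ++ (fwd a ps₁ ++ u)))
  SameCut-decomposition (t , refl , refl)
    with ps₁ , π , b , ps₂ , u , v , ps≡ , π≡ , fwdˡ≡ , fwdʳ≡ , bwdˡ≡ , bwdʳ≡ ← cut-decomposition t
    = ps₁ , π , b , ps₂ , u , v , ps≡ , π≡ ,
      trans (cong₂ _++_ bwdʳ≡ bwdˡ≡) (++-assoc v _ _) ,
      trans (cong₂ _++_ fwdʳ≡ fwdˡ≡) (++-assoc v _ _)

lemma9 : (A : Set) (_<_ : Rel A Level.zero) → IsStrictTotalOrder _≡_ _<_ →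
    (w : List A) → Primitive w →
    (a₁ : A) (ps : List (List A × A)) →
    w ≡ fwd a₁ ps →
    AllPairs _<_ (letters a₁ ps) →
    (∀ x → (x ∈ w) ⇔ (x ∈ letters a₁ ps)) →
    Conjugate w (bwd a₁ ps) →
    (∀ (w′ w″ : List A) → Conjugate w w′ → Conjugate w w″ →
       Lex-< _≡_ _<_ w′ w″ →
       (∀ z → Conjugate w z → ¬ (Lex-< _≡_ _<_ w′ z × Lex-< _≡_ _<_ z w″)) →
       ∃[ ps₁ ] ∃[ π ] ∃[ b ] ∃[ ps₂ ] ∃[ u ] ∃[ v ]
         (ps ≡ ps₁ ++ ((π , b) ∷ ps₂) ×
          π ≡ u ++ v ×
          w′ ≡ v ++ (bwd a₁ ps₁ ++ (bwd b ps₂ ++ u)) ×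
          w″ ≡ v ++ (fwd b ps₂ ++ (fwd a₁ ps₁ ++ u))))
    × (∀ z → Conjugate w z → Lex-≤ _≡_ _<_ w z × Lex-≤ _≡_ _<_ z (bwd a₁ ps))
lemma9 A _<_ sto w prim a₁ ps refl ordered _ w~W =
  (λ w′ w″ w~w′ w~w″ w′<w″ nothing-between → SameCut-decomposition a₁ ps
     (consecutive⇒R (∈C⁺ w~w′) (∈C⁺ w~w″) w′<w″ (nothing-between _ ∘ ∈C⁻))) ,
  (λ z w~z → ≮⇒Lex-≤ sto (w-minimum (∈C⁺ w~z)) , ≮⇒Lex-≤ sto (M-maximum (∈C⁺ w~z)))
  where
  sto-lex : IsStrictTotalOrder _≡_ (Lex-< _≡_ _<_)
  sto-lex = Lex-<-isStrictTotalOrder sto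
  open IsStrictTotalOrder sto-lex using (_≟_)

  C : List (List A)
  C = deduplicate _≟_ (conjugates w)

  ∈C⁺ : ∀ {z} → Conjugate w z → z ∈ C
  ∈C⁺ = ∈-deduplicate⁺ _≟_ ∘ ∈-conjugates⁺

  ∈C⁻ : ∀ {z} → z ∈ C → Conjugate w z
  ∈C⁻ = ∈-conjugates⁻ ∘ ∈-deduplicate⁻ _≟_ (conjugates w)

  open IncreasingInjection sto-lex (deduplicate-! _≟_ (conjugates w)) {R = SameCut a₁ ps}
    (∈C⁺ ∘ proj₂ ∘ SameCut-conjugates a₁ ps)
    (SameCut-increasing a₁ ps ordered)
    (SameCut-injective a₁ ps prim)
    (λ c∈C → SameCut-from-bwd a₁ ps (conjugate-trans (conjugate-sym w~W) (∈C⁻ c∈C)))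

  w-minimum : ∀ {z} → z ∈ C → ¬ Lex-< _≡_ _<_ z w
  w-minimum = sole-maximal⇒maximum (Flip.isStrictTotalOrder sto-lex) λ d∈C d≢w →
    let c , cd = SameCut-from-fwd a₁ ps (∈C⁻ d∈C) d≢w
    in c , ∈C⁺ (conjugate-trans w~W (proj₁ (SameCut-conjugates a₁ ps cd))) ,
       SameCut-increasing a₁ ps ordered cd
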